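{- Let $k$ and $r$ be positive integers with $r \ge 2$, $r \mid k$ and $k \ge 2r$. Let $\chi : \{1, 2, \ldots, rk-2r+1\} \to \{0,1\}$ be a 2-coloring such that $\chi(1) = 0$ and $\chi(r-1) = 1$. If at least one of the following holds: (a) $\chi(r) = 0$; (b) $\chi(k-2) = 1$; (c) $\chi(k-1) = 0$; (d) $\chi(k) = 0$; (e) $\chi(rk-2r-1) = 0$; (f) $\chi(rk-2r+1) = 1$, then there exists a solution $(\hat{x}_1, \ldots, \hat{x}_k)$ of the equation $x_1 + \cdots + x_{k-1} = x_k$ with all $\hat{x}_i \in \{1, \ldots, rk-2r+1\}$ such that $\sum_{i=1}^k \chi(\hat{x}_i) \equiv 0 \pmod{r}$.
   Context: A solution $(\hat{x}_1,\ldots,\hat{x}_k)$ is called $r$-zero-sum under $\chi$ if $\sum_{i=1}^k \chi(\hat{x}_i) \equiv 0 \pmod r$. -}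

module Defs where

open import Data.Nat using (ℕ; zero; suc; _+_; _*_; _∸_; _≤_)
open import Data.Bool using (Bool; true; false)
open import Data.Fin using (Fin; inject₁; fromℕ)
open import Data.Product using (_×_)
open import Data.Empty using (⊥)
open import Relation.Binary.PropositionalEquality using (_≡_)

-- A 2-coloring is represented as χ : ℕ → Bool; only its values on
-- {1, …, N} are ever consulted. false = colour 0, true = colour 1.
colourVal : Bool → ℕ
colourVal false = 0
colourVal true  = 1

sumFin : (n : ℕ) → (Fin n → ℕ) → ℕ
sumFin zero    f = 0
sumFin (suc n) f = f Fin.zero + sumFin n (λ i → f (Fin.suc i))

InRange : ℕ → ℕ → Set
InRange N x = (1 ≤ x) × (x ≤ N)

IsSolution : (m : ℕ) → (Fin (suc m) → ℕ) → Set
IsSolution m x = sumFin m (λ i → x (inject₁ i)) ≡ x (fromℕ m)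

-- x₁ + ⋯ + x_{k-1} = x_k for a k-tuple (k = 0 never occurs: k ≥ 2r ≥ 4)
SolvesEq : (k : ℕ) → (Fin k → ℕ) → Set
SolvesEq zero    x = ⊥
SolvesEq (suc m) x = IsSolution m x

-- Write r = m + 2 and k = (q + 2) r, so N = rk − 2r + 1 = r(qr + 2m + 2) + 1, and let
-- S = (r−1)² + (q+1)r and T = ((q+1)r + 1)(r−1).  Four solutions with k − 1 summands
-- taken from {1, r−1, r} are available:
--   S = (r−1)·(r−1) + (q+1)r·1        colour sum r      if χ(S) = 1,
--   S = (r−2)·r + ((q+1)r + 1)·1      colour sum 0      if χ(S) = χ(r) = 0,
--   T = (q+1)r·(r−1) + (r−1)·1        colour sum (q+1)r if χ(T) = 0,
--   T = (r−2)·r + (qr + 1)(r−1) + r·1 colour sum (q+1)r if χ(r) = χ(T) = 1,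
-- using χ(1) = 0 and χ(r−1) = 1.  The four cases exhaust the colourings of S, r and T.

module Submission where

open import Defs
open import Data.Bool using (Bool; true; false)
open import Data.Fin using (Fin; inject₁; fromℕ)
open import Data.List using (List; []; _∷_; _++_; length; map; replicate)
open import Data.List.Properties using (length-++; length-replicate; map-++; map-replicate; map-id)
open import Data.List.Relation.Unary.All using (All; []; _∷_)
open import Data.List.Relation.Unary.All.Properties using (++⁺; replicate⁺)
open import Data.Nat using (ℕ; zero; suc; _+_; _*_; _∸_; _≤_; z≤n; s≤s)
open import Data.Nat.ListAction using (sum)
open import Data.Nat.ListAction.Properties using (sum-++)
open import Data.Nat.Divisibility using (_∣_; divides)
open import Data.Nat.Properties using (+-assoc; +-comm; +-identityʳ; m≤m+n; m+n∸n≡m; *-cancelʳ-≤)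
open import Data.Nat.Tactic.RingSolver using (solve-∀)
open import Data.Product using (_×_; ∃; _,_)
open import Data.Sum using (_⊎_)
open import Function using (_∘_; id)
open import Relation.Binary.PropositionalEquality
  using (_≡_; refl; sym; trans; cong; cong₂; subst; module ≡-Reasoning)

ZeroSumSolution : ℕ → (ℕ → Bool) → ℕ → (k : ℕ) → Set
ZeroSumSolution r χ N k = ∃ λ (x : Fin k → ℕ) →
  (∀ i → InRange N (x i))
  × SolvesEq k x
  × (r ∣ sumFin k (λ i → colourVal (χ (x i))))

withTarget : (xs : List ℕ) → ℕ → Fin (suc (length xs)) → ℕ
withTarget []       T _           = T
withTarget (x ∷ xs) T Fin.zero    = x
withTarget (x ∷ xs) T (Fin.suc i) = withTarget xs T i

sumFin-withTarget-inject₁ : ∀ xs T →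
  sumFin (length xs) (λ i → withTarget xs T (inject₁ i)) ≡ sum xs
sumFin-withTarget-inject₁ []       T = refl
sumFin-withTarget-inject₁ (x ∷ xs) T = cong (x +_) (sumFin-withTarget-inject₁ xs T)

withTarget-fromℕ : ∀ xs T → withTarget xs T (fromℕ (length xs)) ≡ T
withTarget-fromℕ []       T = refl
withTarget-fromℕ (x ∷ xs) T = withTarget-fromℕ xs T

sumFin-map-withTarget : ∀ (f : ℕ → ℕ) xs T →
  sumFin (suc (length xs)) (λ i → f (withTarget xs T i)) ≡ sum (map f xs) + f T
sumFin-map-withTarget f []       T = +-identityʳ (f T)
sumFin-map-withTarget f (x ∷ xs) T =
  trans (cong (f x +_) (sumFin-map-withTarget f xs T)) (sym (+-assoc (f x) _ (f T)))

All-withTarget : ∀ {P : ℕ → Set} {xs T} → All P xs → P T → ∀ i → P (withTarget xs T i)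
All-withTarget []         pT _           = pT
All-withTarget (px ∷ pxs) pT Fin.zero    = px
All-withTarget (px ∷ pxs) pT (Fin.suc i) = All-withTarget pxs pT i

summandsSolution : ∀ {r N k} (χ : ℕ → Bool) (xs : List ℕ) (T : ℕ) →
  suc (length xs) ≡ k → sum xs ≡ T → All (InRange N) xs → InRange N T →
  r ∣ sum (map (colourVal ∘ χ) xs) + colourVal (χ T) →
  ZeroSumSolution r χ N k
summandsSolution {r} χ xs T refl xs-sum xs-inRange T-inRange r∣colours =
  withTarget xs T , All-withTarget xs-inRange T-inRange , solves , r∣colourSum
  where
  solves : SolvesEq (suc (length xs)) (withTarget xs T)
  solves = trans (sumFin-withTarget-inject₁ xs T) (trans xs-sum (sym (withTarget-fromℕ xs T)))
  r∣colourSum : r ∣ sumFin (suc (length xs)) (λ i → colourVal (χ (withTarget xs T i)))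
  r∣colourSum = subst (r ∣_) (sym (sumFin-map-withTarget (colourVal ∘ χ) xs T)) r∣colours

sum-replicate : ∀ n x → sum (replicate n x) ≡ n * x
sum-replicate zero    x = refl
sum-replicate (suc n) x = cong (x +_) (sum-replicate n x)

sum-map-replicate : ∀ (f : ℕ → ℕ) n x → sum (map f (replicate n x)) ≡ n * f x
sum-map-replicate f n x = trans (cong sum (map-replicate f n x)) (sum-replicate n (f x))

sum-map-replicate-++ : ∀ (f : ℕ → ℕ) n x ys →
  sum (map f (replicate n x ++ ys)) ≡ n * f x + sum (map f ys)
sum-map-replicate-++ f n x ys = begin
  sum (map f (replicate n x ++ ys))             ≡⟨ cong sum (map-++ f (replicate n x) ys) ⟩
  sum (map f (replicate n x) ++ map f ys)       ≡⟨ sum-++ (map f (replicate n x)) (map f ys) ⟩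
  sum (map f (replicate n x)) + sum (map f ys)  ≡⟨ cong (_+ sum (map f ys)) (sum-map-replicate f n x) ⟩
  n * f x + sum (map f ys)                      ∎
  where open ≡-Reasoning

blocks : (a u b v c w : ℕ) → List ℕ
blocks a u b v c w = replicate a u ++ replicate b v ++ replicate c w

length-blocks : ∀ a u b v c w → length (blocks a u b v c w) ≡ a + (b + c)
length-blocks a u b v c w = begin
  length (replicate a u ++ replicate b v ++ replicate c w)            ≡⟨ length-++ (replicate a u) ⟩
  length (replicate a u) + length (replicate b v ++ replicate c w)   ≡⟨ cong (length (replicate a u) +_) (length-++ (replicate b v)) ⟩
  length (replicate a u) + (length (replicate b v) + length (replicate c w))
    ≡⟨ cong₂ _+_ (length-replicate a) (cong₂ _+_ (length-replicate b) (length-replicate c)) ⟩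
  a + (b + c)                                                         ∎
  where open ≡-Reasoning

sum-map-blocks : ∀ (f : ℕ → ℕ) a u b v c w →
  sum (map f (blocks a u b v c w)) ≡ a * f u + (b * f v + c * f w)
sum-map-blocks f a u b v c w = begin
  sum (map f (replicate a u ++ replicate b v ++ replicate c w))  ≡⟨ sum-map-replicate-++ f a u _ ⟩
  a * f u + sum (map f (replicate b v ++ replicate c w))         ≡⟨ cong (a * f u +_) (sum-map-replicate-++ f b v _) ⟩
  a * f u + (b * f v + sum (map f (replicate c w)))              ≡⟨ cong (λ n → a * f u + (b * f v + n)) (sum-map-replicate f c w) ⟩
  a * f u + (b * f v + c * f w)                                  ∎
  where open ≡-Reasoning

sum-blocks : ∀ a u b v c w → sum (blocks a u b v c w) ≡ a * u + (b * v + c * w)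
sum-blocks a u b v c w =
  trans (cong sum (sym (map-id (blocks a u b v c w)))) (sum-map-blocks id a u b v c w)

blocksSolution : ∀ {r N k} (χ : ℕ → Bool) (a u b v c w T : ℕ) {bu bv bw bT : Bool} →
  suc (a + (b + c)) ≡ k → a * u + (b * v + c * w) ≡ T →
  InRange N u → InRange N v → InRange N w → InRange N T →
  χ u ≡ bu → χ v ≡ bv → χ w ≡ bw → χ T ≡ bT →
  r ∣ a * colourVal bu + (b * colourVal bv + c * colourVal bw) + colourVal bT →
  ZeroSumSolution r χ N k
blocksSolution {r} χ a u b v c w T len≡k sum≡T u-inRange v-inRange w-inRange T-inRange
  refl refl refl refl r∣colours =
  summandsSolution χ (blocks a u b v c w) T
    (trans (cong suc (length-blocks a u b v c w)) len≡k)
    (trans (sum-blocks a u b v c w) sum≡T)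
    (++⁺ (replicate⁺ a u-inRange) (++⁺ (replicate⁺ b v-inRange) (replicate⁺ c w-inRange)))
    T-inRange
    (subst (λ n → r ∣ n + colourVal (χ T)) (sym (sum-map-blocks (colourVal ∘ χ) a u b v c w)) r∣colours)

module _ (m q : ℕ) (χ : ℕ → Bool) where

  -- The ring solver does not unfold r, k, N, S, T, so the arithmetic facts below are
  -- stated as closed identities in m and q.

  r k N S T : ℕ
  r = 2 + m
  k = (2 + q) * r
  N = r * k ∸ 2 * r + 1
  S = suc m * suc m + suc q * r
  T = (suc q * r + 1) * suc m

  N≡closedForm : N ≡ r * (q * r + 2 * m + 2) + 1
  N≡closedForm = cong (_+ 1) (begin
    r * k ∸ 2 * r                              ≡⟨ cong (_∸ 2 * r) (r*k≡ m q) ⟩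
    r * (q * r + 2 * m + 2) + 2 * r ∸ 2 * r    ≡⟨ m+n∸n≡m _ (2 * r) ⟩
    r * (q * r + 2 * m + 2)                    ∎)
    where
    open ≡-Reasoning
    r*k≡ : ∀ m q → (2 + m) * ((2 + q) * (2 + m)) ≡ (2 + m) * (q * (2 + m) + 2 * m + 2) + 2 * (2 + m)
    r*k≡ = solve-∀

  inRange-byGap : ∀ v d → v + d ≡ r * (q * r + 2 * m + 2) + 1 → 1 ≤ v → InRange N v
  inRange-byGap v d v+d≡N 1≤v = 1≤v , subst (v ≤_) (trans v+d≡N (sym N≡closedForm)) (m≤m+n v d)

  1-inRange : InRange N 1
  1-inRange = inRange-byGap 1 _ (+-comm 1 _) (s≤s z≤n)

  r-1-inRange : InRange N (suc m)
  r-1-inRange = inRange-byGap (suc m) _ (gap m q) (s≤s z≤n)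
    where
    gap : ∀ m q → suc m + ((2 + m) * (q * (2 + m) + 2 * m + 1) + 2) ≡ (2 + m) * (q * (2 + m) + 2 * m + 2) + 1
    gap = solve-∀

  r-inRange : InRange N r
  r-inRange = inRange-byGap r _ (gap m q) (s≤s z≤n)
    where
    gap : ∀ m q → (2 + m) + ((2 + m) * (q * (2 + m) + 2 * m + 1) + 1) ≡ (2 + m) * (q * (2 + m) + 2 * m + 2) + 1
    gap = solve-∀

  S-inRange : InRange N S
  S-inRange = inRange-byGap S _ (gap m q) (s≤s z≤n)
    where
    gap : ∀ m q → (suc m * suc m + suc q * (2 + m)) + suc q * suc m * (2 + m) ≡ (2 + m) * (q * (2 + m) + 2 * m + 2) + 1
    gap = solve-∀

  T-inRange : InRange N T
  T-inRange = inRange-byGap T _ (gap m q) (s≤s z≤n)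
    where
    gap : ∀ m q → (suc q * (2 + m) + 1) * suc m + ((2 + m) * (m + q) + 2) ≡ (2 + m) * (q * (2 + m) + 2 * m + 2) + 1
    gap = solve-∀

  S-from-r-1s : χ 1 ≡ false → χ (suc m) ≡ true → χ S ≡ true → ZeroSumSolution r χ N k
  S-from-r-1s χ1 χr-1 χS = blocksSolution χ (suc m) (suc m) 0 1 (suc q * r) 1 S
    (length≡ m q) (sum≡ m q) r-1-inRange 1-inRange 1-inRange S-inRange
    χr-1 χ1 χ1 χS (divides 1 (colours≡ m q))
    where
    length≡ : ∀ m q → suc (suc m + (0 + suc q * (2 + m))) ≡ (2 + q) * (2 + m)
    length≡ = solve-∀
    sum≡ : ∀ m q → suc m * suc m + (0 * 1 + suc q * (2 + m) * 1) ≡ suc m * suc m + suc q * (2 + m)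
    sum≡ = solve-∀
    colours≡ : ∀ m q → suc m * 1 + (0 * 0 + suc q * (2 + m) * 0) + 1 ≡ 1 * (2 + m)
    colours≡ = solve-∀

  S-from-rs : χ 1 ≡ false → χ r ≡ false → χ S ≡ false → ZeroSumSolution r χ N k
  S-from-rs χ1 χr χS = blocksSolution χ m r 0 1 (suc q * r + 1) 1 S
    (length≡ m q) (sum≡ m q) r-inRange 1-inRange 1-inRange S-inRange
    χr χ1 χ1 χS (divides 0 (colours≡ m q))
    where
    length≡ : ∀ m q → suc (m + (0 + (suc q * (2 + m) + 1))) ≡ (2 + q) * (2 + m)
    length≡ = solve-∀
    sum≡ : ∀ m q → m * (2 + m) + (0 * 1 + (suc q * (2 + m) + 1) * 1) ≡ suc m * suc m + suc q * (2 + m)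
    sum≡ = solve-∀
    colours≡ : ∀ m q → m * 0 + (0 * 0 + (suc q * (2 + m) + 1) * 0) + 0 ≡ 0 * (2 + m)
    colours≡ = solve-∀

  T-from-r-1s : χ 1 ≡ false → χ (suc m) ≡ true → χ T ≡ false → ZeroSumSolution r χ N k
  T-from-r-1s χ1 χr-1 χT = blocksSolution χ (suc q * r) (suc m) 0 1 (suc m) 1 T
    (length≡ m q) (sum≡ m q) r-1-inRange 1-inRange 1-inRange T-inRange
    χr-1 χ1 χ1 χT (divides (suc q) (colours≡ m q))
    where
    length≡ : ∀ m q → suc (suc q * (2 + m) + (0 + suc m)) ≡ (2 + q) * (2 + m)
    length≡ = solve-∀
    sum≡ : ∀ m q → suc q * (2 + m) * suc m + (0 * 1 + suc m * 1) ≡ (suc q * (2 + m) + 1) * suc m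
    sum≡ = solve-∀
    colours≡ : ∀ m q → suc q * (2 + m) * 1 + (0 * 0 + suc m * 0) + 0 ≡ suc q * (2 + m)
    colours≡ = solve-∀

  T-from-rs-and-r-1s : χ 1 ≡ false → χ (suc m) ≡ true → χ r ≡ true → χ T ≡ true →
    ZeroSumSolution r χ N k
  T-from-rs-and-r-1s χ1 χr-1 χr χT = blocksSolution χ m r (q * r + 1) (suc m) r 1 T
    (length≡ m q) (sum≡ m q) r-inRange r-1-inRange 1-inRange T-inRange
    χr χr-1 χ1 χT (divides (suc q) (colours≡ m q))
    where
    length≡ : ∀ m q → suc (m + ((q * (2 + m) + 1) + (2 + m))) ≡ (2 + q) * (2 + m)
    length≡ = solve-∀
    sum≡ : ∀ m q → m * (2 + m) + ((q * (2 + m) + 1) * suc m + (2 + m) * 1) ≡ (suc q * (2 + m) + 1) * suc m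
    sum≡ = solve-∀
    colours≡ : ∀ m q → m * 1 + ((q * (2 + m) + 1) * 1 + (2 + m) * 0) + 1 ≡ suc q * (2 + m)
    colours≡ = solve-∀

  zeroSumSolution : χ 1 ≡ false → χ (suc m) ≡ true → ZeroSumSolution r χ N k
  zeroSumSolution χ1 χr-1 with χ S in χS | χ r in χr | χ T in χT
  ... | true  | _     | _     = S-from-r-1s χ1 χr-1 χS
  ... | false | false | _     = S-from-rs χ1 χr χS
  ... | false | true  | false = T-from-r-1s χ1 χr-1 χT
  ... | false | true  | true  = T-from-rs-and-r-1s χ1 χr-1 χr χT

lemma2 : (k r : ℕ) → 2 ≤ r → r ∣ k → 2 * r ≤ k →
    (χ : ℕ → Bool) →
    χ 1 ≡ false → χ (r ∸ 1) ≡ true →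
    (χ r ≡ false ⊎ χ (k ∸ 2) ≡ true ⊎ χ (k ∸ 1) ≡ false ⊎ χ k ≡ false
      ⊎ χ (r * k ∸ 2 * r ∸ 1) ≡ false ⊎ χ (r * k ∸ 2 * r + 1) ≡ true) →
    ∃ λ (x : Fin k → ℕ) →
      (∀ i → InRange (r * k ∸ 2 * r + 1) (x i))
      × SolvesEq k x
      × (r ∣ sumFin k (λ i → colourVal (χ (x i))))
lemma2 .(q′ * suc (suc m)) (suc (suc m)) (s≤s (s≤s _)) (divides q′ refl) 2r≤k χ χ1 χr-1 _
  with *-cancelʳ-≤ 2 q′ (suc (suc m)) 2r≤k
... | s≤s (s≤s {n = q} _) = zeroSumSolution m q χ χ1 χr-1
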